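{- Let $1 \leq k \leq n$ be integers and consider the absent-minded passengers process with $k$ absent-minded passengers: there are $n$ seats labelled $1,\dots,n$ and $n$ passengers labelled $1,\dots,n$, where the correct seat of passenger $i$ is seat $i$. Passengers board in the order $1,2,\dots,n$. Each of the passengers $1,\dots,k$ chooses a seat uniformly at random among the currently empty seats. Each passenger $i>k$ takes seat $i$ if it is still empty, and otherwise chooses a seat uniformly at random among the currently empty seats. Let $F^{(k)}_n(w_1,\dots,w_n)$ be the multilinear polynomial whose coefficient of $w_{i_1}\cdots w_{i_l}$ (for distinct $i_1,\dots,i_l$) is the probability that the passengers $i_1,\dots,i_l$ all end up in a seat other than their own while every other passenger ends up in his or her own seat. For $0\le r\le k$ let $e_r(w_1,\dots,w_k)$ denote the coefficient of $X^r$ in $\prod_{j=1}^{k}\big((1-w_j)X+w_j\big)$. Then $$F^{(k)}_n(w_1,\dots,w_n)=\frac{1}{n!}\sum_{r=0}^{k} r!\, e_{k-r}(w_1,\dots,w_k)\prod_{j=k+1}^{n}(rw_j+n+1-j).$$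
   Context: $w_1,\dots,w_n$ and $X$ are commuting indeterminates. An empty product equals $1$. -}

module Defs where

open import Data.Nat as ℕ using (ℕ; zero; suc; _<ᵇ_; _!; _∸_)
open import Data.Nat.Properties using (_!≢0)
open import Data.Integer using (+_)
open import Data.Rational using (ℚ; 0ℚ; 1ℚ; _+_; _*_; _-_; _/_)
open import Data.Fin using (Fin; toℕ)
open import Data.Fin.Properties using (_≟_)
open import Data.Fin.Subset using (Subset; _∪_; ⁅_⁆)
open import Data.Vec using (Vec; []; _∷_; tabulate; lookup)
import Data.Vec.Properties as VecP
import Data.Bool.Properties as BoolP
open import Data.Bool using (Bool; true; false; if_then_else_; _∧_; not; _∨_)
open import Data.List using (List; []; _∷_; _++_; map; concatMap; length; allFin; foldr; upTo)
open import Data.Product using (_×_; _,_)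
open import Relation.Nullary using (does)

-- Conventions: passengers and seats are indexed by Fin n (0-based);
-- passenger / seat number i+1 of the paper is index i : Fin n.

Σℚ : ∀ {A : Set} → List A → (A → ℚ) → ℚ
Σℚ xs f = foldr (λ x acc → f x + acc) 0ℚ xs

Πℚ : ∀ {A : Set} → List A → (A → ℚ) → ℚ
Πℚ xs f = foldr (λ x acc → f x * acc) 1ℚ xs

ℕ→ℚ : ℕ → ℚ
ℕ→ℚ m = + m / 1

keep : ∀ {A : Set} → (A → Bool) → List A → List A
keep p [] = []
keep p (x ∷ xs) = if p x then x ∷ keep p xs else keep p xs

-- The process.  A (finite) probability distribution is a list of
-- (probability, outcome) pairs; an outcome is the list of
-- (passenger, seat taken) pairs in boarding order.

Outcome : ℕ → Set
Outcome n = List (Fin n × Fin n)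

Dist : ℕ → Set
Dist n = List (ℚ × Outcome n)

emptySeats : ∀ {n} → Subset n → List (Fin n)
emptySeats {n} occ = keep (λ s → not (lookup occ s)) (allFin n)

seatThen : ∀ {n} → Fin n → Fin n → Dist n → Dist n
seatThen p s d = map (λ { (q , o) → (q , (p , s) ∷ o) }) d

scale : ∀ {n} → ℚ → Dist n → Dist n
scale u d = map (λ { (q , o) → (u * q , o) }) d

run : ∀ {n} → (k : ℕ) → List (Fin n) → Subset n → Dist n
run k [] occ = (1ℚ , []) ∷ []
run k (p ∷ ps) occ =
  if (toℕ p <ᵇ k) ∨ lookup occ p
  then uniform (emptySeats occ)
  else seatThen p p (run k ps (occ ∪ ⁅ p ⁆))
  where
    uniform : List _ → Dist _
    uniform [] = []
    uniform es@(_ ∷ rest) =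
      concatMap (λ s → scale ((+ 1 / length es) {{_}}) (seatThen p s (run k ps (occ ∪ ⁅ s ⁆)))) es

process : (k n : ℕ) → Dist n
process k n = run k (allFin n) (tabulate (λ _ → false))

misplaced : ∀ {n} → Outcome n → Subset n
misplaced o = tabulate (λ i → anyWrong i o)
  where
    anyWrong : ∀ {n} → Fin n → Outcome n → Bool
    anyWrong i [] = false
    anyWrong i ((p , s) ∷ o) = (does (p ≟ i) ∧ not (does (s ≟ i))) ∨ anyWrong i o

probMisplaced : (k n : ℕ) → Subset n → ℚ
probMisplaced k n S =
  Σℚ (process k n) (λ { (q , o) → if does (VecP.≡-dec BoolP._≟_ (misplaced o) S) then q else 0ℚ })

allSubsets : (n : ℕ) → List (Subset n)
allSubsets zero = [] ∷ []
allSubsets (suc n) = map (true ∷_) (allSubsets n) ++ map (false ∷_) (allSubsets n)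

monomial : ∀ {n} → Subset n → (Fin n → ℚ) → ℚ
monomial {n} S w = Πℚ (allFin n) (λ i → if lookup S i then w i else 1ℚ)

F : (k n : ℕ) → (Fin n → ℚ) → ℚ
F k n w = Σℚ (allSubsets n) (λ S → probMisplaced k n S * monomial S w)

-- Polynomials in X as coefficient lists (constant term first)

addP : List ℚ → List ℚ → List ℚ
addP [] q = q
addP p [] = p
addP (a ∷ p) (b ∷ q) = (a + b) ∷ addP p q

mulLin : ℚ → ℚ → List ℚ → List ℚ
mulLin a b p = addP (0ℚ ∷ map (a *_) p) (map (b *_) p)

coeff : List ℚ → ℕ → ℚ
coeff [] _ = 0ℚ
coeff (c ∷ _) zero = c
coeff (_ ∷ p) (suc r) = coeff p r

e : (k : ℕ) → ∀ {n} → (Fin n → ℚ) → ℕ → ℚ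
e k {n} w r =
  coeff (foldr (λ j acc → mulLin (1ℚ - w j) (w j) acc) (1ℚ ∷ [])
               (keep (λ j → toℕ j <ᵇ k) (allFin n))) r

-- right-hand side:
-- (1/n!) Σ_{r=0}^{k} r! e_{k-r}(w_1..w_k) ∏_{j=k+1}^{n} (r w_j + n + 1 - j)
-- (with 0-based index j' = j - 1, the factor n+1-j is n - j')
RHS : (k n : ℕ) → (Fin n → ℚ) → ℚ
RHS k n w =
  ((+ 1 / (n !)) {{n !≢0}}) *
  Σℚ (upTo (suc k)) (λ r →
    ℕ→ℚ (r !) * e k w (k ∸ r) *
    Πℚ (keep (λ j → not (toℕ j <ᵇ k)) (allFin n))
       (λ j → ℕ→ℚ r * w j + ℕ→ℚ (n ∸ toℕ j)))

-- Write Q ps occ 0 for |ps|! times the expected weight of the process that is still to run when the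
-- passengers ps have yet to board and the seats occ are taken.  Extend it to a function Q ps occ r of an
-- auxiliary r ≥ 0 given by one linear operator per waiting passenger p: when p's own seat is taken,
-- f ↦ (r + 1) w_p f (r + 1); when p is absent-minded and the seat is free, additionally + (1 − w_p) f r; and
-- when p is normal and the seat is free, f ↦ (r w_p + n + 1 − p) f r.  Each operator preserves the identity
--   (r + 1) Q (r + 1) = (c + r + 1) Q r + Σ_s Q(occ ∪ {s}) r,
-- where c counts the taken seats among ps and s runs over the free ones; at r = 0 this is exactly what
-- is needed to absorb a uniformly random choice of seat, so by induction along the boarding order Q ps occ 0
-- really is |ps|! times the expected weight.  Initially no seat is taken: the operators of the normal
-- passengers give ∏_{j>k} (r w_j + n + 1 − j), and those of the absent-minded ones act on r! Q r as
-- g ↦ w_j g (r + 1) + (1 − w_j) g r, hence convolve r ↦ r! ∏_{j>k} (r w_j + n + 1 − j) with the coefficients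
-- of ∏_{j≤k} ((1 − w_j) X + w_j).  At r = 0 this is n! times the right-hand side.

module Submission where

open import Defs
open import Data.Nat as ℕ using (ℕ; zero; suc; _≤_; _<ᵇ_; _!; _∸_; s≤s)
import Data.Nat.Properties as ℕP
import Data.Integer as ℤ
import Data.Integer.Properties as ℤP
open import Data.Nat.Coprimality using (1-coprimeTo) renaming (sym to coprime-sym)
open import Data.Rational using (ℚ; 0ℚ; 1ℚ; _+_; _*_; _-_; _/_; mkℚ)
open import Data.Rational.Properties
  using (+-0-commutativeMonoid; *-1-commutativeMonoid; +-comm; +-identityˡ; +-identityʳ; +-assoc;
         *-identityˡ; *-identityʳ; *-zeroˡ; *-zeroʳ; *-assoc; *-comm; *-distribˡ-+; *-distribʳ-+;
         normalize-coprime; /-cong; *-inverseˡ)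
open import Data.Rational.Solver using (module +-*-Solver)
open +-*-Solver using (solve; _:+_; _:*_; _:-_; _:=_; con)
open import Algebra.Bundles using (CommutativeMonoid)
import Algebra.Properties.CommutativeSemigroup as CommSemigroupProperties
open import Data.Fin as Fin using (Fin; toℕ; zero; suc)
open import Data.Fin.Properties using (_≟_; suc-injective)
open import Data.Fin.Subset using (Subset; _∪_; ⁅_⁆)
open import Data.Vec as Vec using (tabulate; lookup)
import Data.Vec.Properties as VecP
open import Data.Bool using (Bool; true; false; if_then_else_; not; _∧_; _∨_)
import Data.Bool.Properties as BoolP
open import Data.List using (List; []; _∷_; _++_; [_]; map; concatMap; length; allFin; foldr; upTo; _∷ʳ_)
import Data.List.Properties as LP
open import Data.List.Relation.Unary.All as All using (All; []; _∷_)
import Data.List.Relation.Unary.All.Properties as AllP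
open import Data.List.Relation.Unary.Any using (here; there)
open import Data.List.Relation.Unary.AllPairs using ([]; _∷_)
open import Data.List.Relation.Unary.Unique.Propositional using (Unique)
import Data.List.Relation.Unary.Unique.Propositional.Properties as UniqueP
open import Data.List.Membership.Propositional using (_∈_; _∉_)
import Data.List.Membership.Propositional.Properties as MembershipP
open import Data.Product using (_×_; _,_; proj₁; proj₂; ∃-syntax)
open import Data.Empty using (⊥-elim)
open import Function using (_∘_)
open import Relation.Nullary using (does; yes; no)
open import Relation.Binary.PropositionalEquality hiding ([_])

open AllP using (All¬⇒¬Any)
open CommSemigroupProperties (CommutativeMonoid.commutativeSemigroup +-0-commutativeMonoid)
  using () renaming (interchange to +-interchange)
open CommSemigroupProperties (CommutativeMonoid.commutativeSemigroup *-1-commutativeMonoid)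
  using () renaming (x∙yz≈y∙xz to *-left-comm; xy∙z≈xz∙y to *-right-comm)

private
  variable
    A B : Set

𝟙 : Bool → ℕ
𝟙 true  = 1
𝟙 false = 0

ℕ→ℚ-mkℚ : ∀ m → ℕ→ℚ m ≡ mkℚ (ℤ.+ m) 0 (coprime-sym (1-coprimeTo m))
ℕ→ℚ-mkℚ m = normalize-coprime (coprime-sym (1-coprimeTo m))

ℕ→ℚ-+ : ∀ a b → ℕ→ℚ (a ℕ.+ b) ≡ ℕ→ℚ a + ℕ→ℚ b
ℕ→ℚ-+ a b rewrite ℕ→ℚ-mkℚ a | ℕ→ℚ-mkℚ b =
  /-cong (trans (ℤP.pos-+ a b) (sym (cong₂ ℤ._+_ (ℤP.*-identityʳ (ℤ.+ a)) (ℤP.*-identityʳ (ℤ.+ b))))) refl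

ℕ→ℚ-* : ∀ a b → ℕ→ℚ (a ℕ.* b) ≡ ℕ→ℚ a * ℕ→ℚ b
ℕ→ℚ-* a b rewrite ℕ→ℚ-mkℚ a | ℕ→ℚ-mkℚ b = /-cong (ℤP.pos-* a b) refl

1/n*n≡1 : ∀ m .{{_ : ℕ.NonZero m}} → (ℤ.+ 1 / m) * ℕ→ℚ m ≡ 1ℚ
1/n*n≡1 (suc m) rewrite ℕ→ℚ-mkℚ (suc m) | normalize-coprime {1} {m} (1-coprimeTo (suc m)) =
  *-inverseˡ (mkℚ (ℤ.+ suc m) 0 (coprime-sym (1-coprimeTo (suc m))))

if-then-0-* : ∀ b (x y : ℚ) → (if b then x else 0ℚ) * y ≡ (if b then x * y else 0ℚ)
if-then-0-* true  x y = refl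
if-then-0-* false x y = *-zeroˡ y

Σℚ-++ : ∀ (xs ys : List A) f → Σℚ (xs ++ ys) f ≡ Σℚ xs f + Σℚ ys f
Σℚ-++ []       ys f = sym (+-identityˡ _)
Σℚ-++ (x ∷ xs) ys f = trans (cong (f x +_) (Σℚ-++ xs ys f)) (sym (+-assoc (f x) _ _))

Σℚ-cong : ∀ (xs : List A) {f g} → (∀ {x} → x ∈ xs → f x ≡ g x) → Σℚ xs f ≡ Σℚ xs g
Σℚ-cong []       eq = refl
Σℚ-cong (x ∷ xs) eq = cong₂ _+_ (eq (here refl)) (Σℚ-cong xs (eq ∘ there))

Σℚ-map : ∀ (h : A → B) xs f → Σℚ (map h xs) f ≡ Σℚ xs (f ∘ h)
Σℚ-map h []       f = refl
Σℚ-map h (x ∷ xs) f = cong (f (h x) +_) (Σℚ-map h xs f)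

Σℚ-concatMap : ∀ (h : A → List B) xs f → Σℚ (concatMap h xs) f ≡ Σℚ xs (λ x → Σℚ (h x) f)
Σℚ-concatMap h []       f = refl
Σℚ-concatMap h (x ∷ xs) f =
  trans (Σℚ-++ (h x) (concatMap h xs) f) (cong (Σℚ (h x) f +_) (Σℚ-concatMap h xs f))

Σℚ-*ˡ : ∀ (xs : List A) c f → Σℚ xs (λ x → c * f x) ≡ c * Σℚ xs f
Σℚ-*ˡ []       c f = sym (*-zeroʳ c)
Σℚ-*ˡ (x ∷ xs) c f = trans (cong (c * f x +_) (Σℚ-*ˡ xs c f)) (sym (*-distribˡ-+ c (f x) _))

Σℚ-*ʳ : ∀ (xs : List A) c f → Σℚ xs (λ x → f x * c) ≡ Σℚ xs f * c
Σℚ-*ʳ []       c f = sym (*-zeroˡ c)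
Σℚ-*ʳ (x ∷ xs) c f = trans (cong (f x * c +_) (Σℚ-*ʳ xs c f)) (sym (*-distribʳ-+ c (f x) _))

Σℚ-zero : ∀ (xs : List A) → Σℚ xs (λ _ → 0ℚ) ≡ 0ℚ
Σℚ-zero []       = refl
Σℚ-zero (x ∷ xs) = trans (+-identityˡ _) (Σℚ-zero xs)

Σℚ-+ : ∀ (xs : List A) f g → Σℚ xs (λ x → f x + g x) ≡ Σℚ xs f + Σℚ xs g
Σℚ-+ []       f g = sym (+-identityˡ 0ℚ)
Σℚ-+ (x ∷ xs) f g = trans (cong (f x + g x +_) (Σℚ-+ xs f g)) (+-interchange (f x) (g x) _ _)

Σℚ-swap : ∀ (xs : List A) (ys : List B) (f : A → B → ℚ) →
  Σℚ xs (λ x → Σℚ ys (f x)) ≡ Σℚ ys (λ y → Σℚ xs (λ x → f x y))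
Σℚ-swap []       ys f = sym (Σℚ-zero ys)
Σℚ-swap (x ∷ xs) ys f =
  trans (cong (Σℚ ys (f x) +_) (Σℚ-swap xs ys f)) (sym (Σℚ-+ ys (f x) (λ y → Σℚ xs (λ x′ → f x′ y))))

Σℚ-const : ∀ (xs : List A) c → Σℚ xs (λ _ → c) ≡ ℕ→ℚ (length xs) * c
Σℚ-const []       c = sym (*-zeroˡ c)
Σℚ-const (x ∷ xs) c = begin
  c + Σℚ xs (λ _ → c)            ≡⟨ cong (c +_) (Σℚ-const xs c) ⟩
  c + ℕ→ℚ (length xs) * c        ≡⟨ cong (_+ ℕ→ℚ (length xs) * c) (sym (*-identityˡ c)) ⟩
  1ℚ * c + ℕ→ℚ (length xs) * c   ≡⟨ sym (*-distribʳ-+ c 1ℚ (ℕ→ℚ (length xs))) ⟩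
  (1ℚ + ℕ→ℚ (length xs)) * c     ≡⟨ cong (_* c) (sym (ℕ→ℚ-+ 1 (length xs))) ⟩
  ℕ→ℚ (suc (length xs)) * c      ∎
  where open ≡-Reasoning

Σℚ-∷ʳ : ∀ (xs : List A) y f → Σℚ (xs ∷ʳ y) f ≡ Σℚ xs f + f y
Σℚ-∷ʳ xs y f = trans (Σℚ-++ xs [ y ] f) (cong (Σℚ xs f +_) (+-identityʳ (f y)))

Πℚ-cong : ∀ (xs : List A) {f g} → (∀ x → f x ≡ g x) → Πℚ xs f ≡ Πℚ xs g
Πℚ-cong []       eq = refl
Πℚ-cong (x ∷ xs) eq = cong₂ _*_ (eq x) (Πℚ-cong xs eq)

Πℚ-map : ∀ (h : A → B) xs f → Πℚ (map h xs) f ≡ Πℚ xs (f ∘ h)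
Πℚ-map h []       f = refl
Πℚ-map h (x ∷ xs) f = cong (f (h x) *_) (Πℚ-map h xs f)

Πℚ-one : ∀ (xs : List A) → Πℚ xs (λ _ → 1ℚ) ≡ 1ℚ
Πℚ-one []       = refl
Πℚ-one (x ∷ xs) = trans (cong (1ℚ *_) (Πℚ-one xs)) (*-identityˡ 1ℚ)

keep-++ : ∀ (g : A → Bool) xs ys → keep g (xs ++ ys) ≡ keep g xs ++ keep g ys
keep-++ g []       ys = refl
keep-++ g (x ∷ xs) ys with g x
... | true  = cong (x ∷_) (keep-++ g xs ys)
... | false = keep-++ g xs ys

keep-map : ∀ (g : B → Bool) (h : A → B) xs → keep g (map h xs) ≡ map h (keep (g ∘ h) xs)
keep-map g h []       = refl
keep-map g h (x ∷ xs) with g (h x)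
... | true  = cong (h x ∷_) (keep-map g h xs)
... | false = keep-map g h xs

keep-none : ∀ (g : A → Bool) xs → (∀ x → g x ≡ false) → keep g xs ≡ []
keep-none g []       none = refl
keep-none g (x ∷ xs) none rewrite none x = keep-none g xs none

keep-all : ∀ (g : A → Bool) xs → (∀ x → g x ≡ true) → keep g xs ≡ xs
keep-all g []       all = refl
keep-all g (x ∷ xs) all rewrite all x = cong (x ∷_) (keep-all g xs all)

keep-cong : ∀ {g h : A → Bool} xs → (∀ {x} → x ∈ xs → g x ≡ h x) → keep g xs ≡ keep h xs
keep-cong []       eq = refl
keep-cong {h = h} (x ∷ xs) eq rewrite eq (here refl) with h x
... | true  = cong (x ∷_) (keep-cong xs (eq ∘ there))
... | false = keep-cong xs (eq ∘ there)

∈-keep⁻ : ∀ (g : A → Bool) xs {x} → x ∈ keep g xs → x ∈ xs × g x ≡ true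
∈-keep⁻ g (y ∷ xs) x∈ with g y in gy
∈-keep⁻ g (y ∷ xs) (here refl) | true = here refl , gy
∈-keep⁻ g (y ∷ xs) (there x∈)  | true = let x∈xs , gx = ∈-keep⁻ g xs x∈ in there x∈xs , gx
∈-keep⁻ g (y ∷ xs) x∈          | false = let x∈xs , gx = ∈-keep⁻ g xs x∈ in there x∈xs , gx

length-keep-∷ : ∀ (g : A → Bool) x xs → length (keep g (x ∷ xs)) ≡ 𝟙 (g x) ℕ.+ length (keep g xs)
length-keep-∷ g x xs with g x
... | true  = refl
... | false = refl

length-keep-not : ∀ (g : A → Bool) xs → length (keep (not ∘ g) xs) ℕ.+ length (keep g xs) ≡ length xs
length-keep-not g []       = refl
length-keep-not g (x ∷ xs) with g x
... | true  = trans (ℕP.+-suc _ _) (cong suc (length-keep-not g xs))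
... | false = cong suc (length-keep-not g xs)

Σℚ-keep-∷ : ∀ (g : A → Bool) x xs f → Σℚ (keep g (x ∷ xs)) f ≡ ℕ→ℚ (𝟙 (g x)) * f x + Σℚ (keep g xs) f
Σℚ-keep-∷ g x xs f with g x
... | true  = cong (_+ Σℚ (keep g xs) f) (sym (*-identityˡ (f x)))
... | false = trans (sym (+-identityˡ _)) (cong (_+ Σℚ (keep g xs) f) (sym (*-zeroˡ (f x))))

length-keep-remove : ∀ {g h : A → Bool} {s} xs → Unique xs → s ∈ xs → g s ≡ true → h s ≡ false →
  (∀ x → x ≢ s → h x ≡ g x) → length (keep g xs) ≡ suc (length (keep h xs))
length-keep-remove (x ∷ xs) (x∉xs ∷ _) (here refl) gs hs agree rewrite gs | hs =
  cong (suc ∘ length) (keep-cong xs (λ y∈ → sym (agree _ (λ y≡x → All.lookup x∉xs y∈ (sym y≡x)))))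
length-keep-remove {g = g} (x ∷ xs) (x∉xs ∷ unique) (there s∈) gs hs agree
  rewrite agree x (All.lookup x∉xs s∈) with g x
... | true  = cong suc (length-keep-remove xs unique s∈ gs hs agree)
... | false = length-keep-remove xs unique s∈ gs hs agree

Unique-++⁻ʳ : ∀ (xs : List A) {ys} → Unique (xs ++ ys) → Unique ys
Unique-++⁻ʳ []       unique       = unique
Unique-++⁻ʳ (x ∷ xs) (_ ∷ unique) = Unique-++⁻ʳ xs unique

Unique-++-disjoint : ∀ (xs : List A) {ys x} → Unique (xs ++ ys) → x ∈ xs → x ∉ ys
Unique-++-disjoint (x ∷ xs) (x∉ ∷ _)      (here refl) x∈ys = All.lookup x∉ (MembershipP.∈-++⁺ʳ xs x∈ys) refl
Unique-++-disjoint (_ ∷ xs) (_ ∷ unique) (there x∈)  x∈ys = Unique-++-disjoint xs unique x∈ x∈ys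

allFin-suc : ∀ m → allFin (suc m) ≡ zero ∷ map suc (allFin m)
allFin-suc m = cong (zero ∷_) (sym (LP.map-tabulate (λ i → i) suc))

tabulate-position : ∀ {m} (f : Fin m → A) pre x rest → Data.List.tabulate f ≡ pre ++ x ∷ rest →
  ∃[ i ] toℕ i ≡ length pre × f i ≡ x
tabulate-position {m = suc m} f []        x rest eq = zero , refl , LP.∷-injectiveˡ eq
tabulate-position {m = suc m} f (_ ∷ pre) x rest eq
  with i , i≡pre , fi≡x ← tabulate-position (f ∘ suc) pre x rest (LP.∷-injectiveʳ eq) =
  suc i , cong suc i≡pre , fi≡x

allFin-position : ∀ {m} pre (x : Fin m) rest → allFin m ≡ pre ++ x ∷ rest → toℕ x ≡ length pre
allFin-position pre x rest eq with i , i≡pre , refl ← tabulate-position (λ i → i) pre x rest eq = i≡pre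

allFin-∸-position : ∀ {m} pre (x : Fin m) rest → allFin m ≡ pre ++ x ∷ rest → m ∸ toℕ x ≡ suc (length rest)
allFin-∸-position {m} pre x rest eq = begin
  m ∸ toℕ x                                     ≡⟨ cong₂ _∸_ m≡ (allFin-position pre x rest eq) ⟩
  length pre ℕ.+ suc (length rest) ∸ length pre ≡⟨ ℕP.m+n∸m≡n (length pre) _ ⟩
  suc (length rest)                             ∎
  where
    open ≡-Reasoning
    m≡ : m ≡ length pre ℕ.+ suc (length rest)
    m≡ = trans (sym (LP.length-tabulate (λ i → i))) (trans (cong length eq) (LP.length-++ pre))

allFin-suffix-Unique : ∀ {m} pre (p : Fin m) ps → allFin m ≡ pre ++ p ∷ ps → Unique (p ∷ ps)
allFin-suffix-Unique pre p ps split = Unique-++⁻ʳ pre (subst Unique split (UniqueP.allFin⁺ _))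

Πℚ-allFin-suc : ∀ m (f : Fin (suc m) → ℚ) → Πℚ (allFin (suc m)) f ≡ f zero * Πℚ (allFin m) (f ∘ suc)
Πℚ-allFin-suc m f = trans (cong (λ xs → Πℚ xs f) (allFin-suc m)) (cong (f zero *_) (Πℚ-map suc (allFin m) f))

Πℚ-allFin-scaleAt : ∀ {m} (p : Fin m) c (f g : Fin m → ℚ) → g p ≡ c * f p → (∀ i → p ≢ i → g i ≡ f i) →
  Πℚ (allFin m) g ≡ c * Πℚ (allFin m) f
Πℚ-allFin-scaleAt {suc m} zero c f g gp others = begin
  Πℚ (allFin (suc m)) g                    ≡⟨ Πℚ-allFin-suc m g ⟩
  g zero * Πℚ (allFin m) (g ∘ suc)         ≡⟨ cong₂ _*_ gp (Πℚ-cong (allFin m) (λ i → others (suc i) (λ ()))) ⟩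
  c * f zero * Πℚ (allFin m) (f ∘ suc)     ≡⟨ *-assoc c _ _ ⟩
  c * (f zero * Πℚ (allFin m) (f ∘ suc))   ≡⟨ cong (c *_) (sym (Πℚ-allFin-suc m f)) ⟩
  c * Πℚ (allFin (suc m)) f                ∎
  where open ≡-Reasoning
Πℚ-allFin-scaleAt {suc m} (suc p) c f g gp others = begin
  Πℚ (allFin (suc m)) g                    ≡⟨ Πℚ-allFin-suc m g ⟩
  g zero * Πℚ (allFin m) (g ∘ suc)
    ≡⟨ cong₂ _*_ (others zero (λ ()))
                 (Πℚ-allFin-scaleAt p c (f ∘ suc) (g ∘ suc) gp (λ i p≢i → others (suc i) (p≢i ∘ suc-injective))) ⟩
  f zero * (c * Πℚ (allFin m) (f ∘ suc))   ≡⟨ *-left-comm (f zero) c _ ⟩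
  c * (f zero * Πℚ (allFin m) (f ∘ suc))   ≡⟨ cong (c *_) (sym (Πℚ-allFin-suc m f)) ⟩
  c * Πℚ (allFin (suc m)) f                ∎
  where open ≡-Reasoning

absentMinded : ∀ {n} → ℕ → Fin n → Bool
absentMinded k j = toℕ j <ᵇ k

allFin-partition : ∀ n k →
  allFin n ≡ keep (absentMinded k) (allFin n) ++ keep (not ∘ absentMinded k) (allFin n)
allFin-partition zero    k       = refl
allFin-partition (suc n) zero    =
  sym (cong₂ _++_ (keep-none _ (allFin (suc n)) (λ _ → refl)) (keep-all _ (allFin (suc n)) (λ _ → refl)))
allFin-partition (suc n) (suc k) = begin
  allFin (suc n)                                              ≡⟨ allFin-suc n ⟩
  zero ∷ map suc (allFin n)                                   ≡⟨ cong (λ xs → zero ∷ map suc xs) (allFin-partition n k) ⟩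
  zero ∷ map suc (keep (absentMinded k) (allFin n) ++ keep (not ∘ absentMinded k) (allFin n))
    ≡⟨ cong (zero ∷_) (LP.map-++ suc (keep (absentMinded k) (allFin n)) _) ⟩
  zero ∷ map suc (keep (absentMinded k) (allFin n)) ++ map suc (keep (not ∘ absentMinded k) (allFin n))
    ≡⟨ sym (cong₂ (λ as bs → zero ∷ as ++ bs) (keep-map _ suc (allFin n)) (keep-map _ suc (allFin n))) ⟩
  zero ∷ keep (absentMinded (suc k)) (map suc (allFin n)) ++ keep (not ∘ absentMinded (suc k)) (map suc (allFin n))
    ≡⟨ sym (cong (λ xs → keep (absentMinded (suc k)) xs ++ keep (not ∘ absentMinded (suc k)) xs) (allFin-suc n)) ⟩
  keep (absentMinded (suc k)) (allFin (suc n)) ++ keep (not ∘ absentMinded (suc k)) (allFin (suc n)) ∎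
  where open ≡-Reasoning

length-keep-absentMinded : ∀ n k → k ≤ n → length (keep (absentMinded k) (allFin n)) ≡ k
length-keep-absentMinded n       zero    _         = cong length (keep-none _ (allFin n) (λ _ → refl))
length-keep-absentMinded (suc n) (suc k) (s≤s k≤n) = begin
  length (keep (absentMinded (suc k)) (allFin (suc n)))      ≡⟨ cong (length ∘ keep (absentMinded (suc k))) (allFin-suc n) ⟩
  suc (length (keep (absentMinded (suc k)) (map suc (allFin n)))) ≡⟨ cong (suc ∘ length) (keep-map _ suc (allFin n)) ⟩
  suc (length (map suc (keep (absentMinded k) (allFin n))))  ≡⟨ cong suc (LP.length-map Fin.suc (keep (absentMinded k) (allFin n))) ⟩
  suc (length (keep (absentMinded k) (allFin n)))            ≡⟨ cong suc (length-keep-absentMinded n k k≤n) ⟩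
  suc k                                                      ∎
  where open ≡-Reasoning

lookup-⁅⁆ : ∀ {m} (s x : Fin m) → lookup ⁅ s ⁆ x ≡ does (s ≟ x)
lookup-⁅⁆ zero    zero    = refl
lookup-⁅⁆ zero    (suc x) = VecP.lookup-replicate x false
lookup-⁅⁆ (suc s) zero    = refl
lookup-⁅⁆ (suc s) (suc x) = lookup-⁅⁆ s x

lookup-occupy : ∀ {m} (occ : Subset m) s x → lookup (occ ∪ ⁅ s ⁆) x ≡ lookup occ x ∨ does (s ≟ x)
lookup-occupy occ s x = trans (VecP.lookup-zipWith _∨_ x occ ⁅ s ⁆) (cong (lookup occ x ∨_) (lookup-⁅⁆ s x))

lookup-occupy-self : ∀ {m} (occ : Subset m) s → lookup (occ ∪ ⁅ s ⁆) s ≡ true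
lookup-occupy-self occ s with s ≟ s | lookup-occupy occ s s
... | yes _   | eq = trans eq (BoolP.∨-zeroʳ _)
... | no s≢s | _  = ⊥-elim (s≢s refl)

lookup-occupy-other : ∀ {m} (occ : Subset m) {s x} → s ≢ x → lookup (occ ∪ ⁅ s ⁆) x ≡ lookup occ x
lookup-occupy-other occ {s} {x} s≢x with s ≟ x | lookup-occupy occ s x
... | yes s≡x | _  = ⊥-elim (s≢x s≡x)
... | no _    | eq = trans eq (BoolP.∨-identityʳ _)

allEmpty : ∀ {m} → Subset m
allEmpty = tabulate (λ _ → false)

lookup-allEmpty : ∀ {m} (j : Fin m) → lookup allEmpty j ≡ false
lookup-allEmpty j = VecP.lookup∘tabulate _ j

length-emptySeats-occupy : ∀ {m} (occ : Subset m) s → lookup occ s ≡ false →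
  length (emptySeats occ) ≡ suc (length (emptySeats (occ ∪ ⁅ s ⁆)))
length-emptySeats-occupy {m} occ s free =
  length-keep-remove (allFin m) (UniqueP.allFin⁺ m) (MembershipP.∈-allFin s)
    (cong not free) (cong not (lookup-occupy-self occ s)) (λ x x≢s → cong not (lookup-occupy-other occ (x≢s ∘ sym)))

Σℚ-allSubsets-select : ∀ {m} (T : Subset m) (g : Subset m → ℚ) →
  Σℚ (allSubsets m) (λ S → if does (VecP.≡-dec BoolP._≟_ T S) then g S else 0ℚ) ≡ g T
Σℚ-allSubsets-select {zero}  Vec.[]       g = +-identityʳ (g Vec.[])
Σℚ-allSubsets-select {suc m} (b Vec.∷ T) g = begin
  Σℚ (map (true Vec.∷_) L ++ map (false Vec.∷_) L) G
    ≡⟨ Σℚ-++ (map (true Vec.∷_) L) _ G ⟩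
  Σℚ (map (true Vec.∷_) L) G + Σℚ (map (false Vec.∷_) L) G
    ≡⟨ cong₂ _+_ (Σℚ-map (true Vec.∷_) L G) (Σℚ-map (false Vec.∷_) L G) ⟩
  Σℚ L (G ∘ (true Vec.∷_)) + Σℚ L (G ∘ (false Vec.∷_))
    ≡⟨ select b ⟩
  g (b Vec.∷ T) ∎
  where
    open ≡-Reasoning
    L = allSubsets m
    G : Subset (suc m) → ℚ
    G S = if does (VecP.≡-dec BoolP._≟_ (b Vec.∷ T) S) then g S else 0ℚ
    select : ∀ c → Σℚ L (λ S → if does (VecP.≡-dec BoolP._≟_ (c Vec.∷ T) (true Vec.∷ S)) then g (true Vec.∷ S) else 0ℚ)
                 + Σℚ L (λ S → if does (VecP.≡-dec BoolP._≟_ (c Vec.∷ T) (false Vec.∷ S)) then g (false Vec.∷ S) else 0ℚ)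
                 ≡ g (c Vec.∷ T)
    select true  = trans (cong₂ _+_ (Σℚ-allSubsets-select T (g ∘ (true Vec.∷_))) (Σℚ-zero L)) (+-identityʳ _)
    select false = trans (cong₂ _+_ (Σℚ-zero L) (Σℚ-allSubsets-select T (g ∘ (false Vec.∷_)))) (+-identityˡ _)

misplaced-[] : ∀ {m} (i : Fin m) → lookup (misplaced []) i ≡ false
misplaced-[] i = VecP.lookup∘tabulate _ i

misplaced-∷ : ∀ {m} (p s : Fin m) o i →
  lookup (misplaced ((p , s) ∷ o)) i ≡ (does (p ≟ i) ∧ not (does (s ≟ i))) ∨ lookup (misplaced o) i
misplaced-∷ p s o i =
  trans (VecP.lookup∘tabulate _ i) (cong ((does (p ≟ i) ∧ not (does (s ≟ i))) ∨_) (sym (VecP.lookup∘tabulate _ i)))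

-- Convolution with a coefficient list

convolve : ℕ → (ℕ → ℚ) → List ℚ → ℚ
convolve m       f []       = 0ℚ
convolve zero    f (c ∷ cs) = c * f zero
convolve (suc m) f (c ∷ cs) = c * f (suc m) + convolve m f cs

convolve-cong : ∀ m {f g} → (∀ r → f r ≡ g r) → ∀ p → convolve m f p ≡ convolve m g p
convolve-cong m       eq []       = refl
convolve-cong zero    eq (c ∷ p) = cong (c *_) (eq zero)
convolve-cong (suc m) eq (c ∷ p) = cong₂ _+_ (cong (c *_) (eq (suc m))) (convolve-cong m eq p)

convolve-one : ∀ m f → convolve m f (1ℚ ∷ []) ≡ f m
convolve-one zero    f = *-identityˡ (f zero)
convolve-one (suc m) f = trans (+-identityʳ _) (*-identityˡ (f (suc m)))

convolve-addP : ∀ m f p q → convolve m f (addP p q) ≡ convolve m f p + convolve m f q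
convolve-addP m       f []      q       = sym (+-identityˡ _)
convolve-addP m       f (a ∷ p) []      = sym (+-identityʳ _)
convolve-addP zero    f (a ∷ p) (b ∷ q) = *-distribʳ-+ (f zero) a b
convolve-addP (suc m) f (a ∷ p) (b ∷ q) =
  trans (cong₂ _+_ (*-distribʳ-+ (f (suc m)) a b) (convolve-addP m f p q))
        (+-interchange (a * f (suc m)) (b * f (suc m)) _ _)

convolve-scale : ∀ m f a p → convolve m f (map (a *_) p) ≡ a * convolve m f p
convolve-scale m       f a []      = sym (*-zeroʳ a)
convolve-scale zero    f a (c ∷ p) = *-assoc a c (f zero)
convolve-scale (suc m) f a (c ∷ p) =
  trans (cong₂ _+_ (*-assoc a c (f (suc m))) (convolve-scale m f a p)) (sym (*-distribˡ-+ a _ _))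

convolve-mulLin : ∀ m f a b p → convolve (suc m) f (mulLin a b p) ≡ a * convolve m f p + b * convolve (suc m) f p
convolve-mulLin m f a b p = begin
  convolve (suc m) f (addP (0ℚ ∷ map (a *_) p) (map (b *_) p))
    ≡⟨ convolve-addP (suc m) f (0ℚ ∷ map (a *_) p) (map (b *_) p) ⟩
  0ℚ * f (suc m) + convolve m f (map (a *_) p) + convolve (suc m) f (map (b *_) p)
    ≡⟨ cong₂ _+_ (trans (cong (_+ convolve m f (map (a *_) p)) (*-zeroˡ (f (suc m)))) (+-identityˡ (convolve m f (map (a *_) p))))
                 (convolve-scale (suc m) f b p) ⟩
  convolve m f (map (a *_) p) + b * convolve (suc m) f p
    ≡⟨ cong (_+ b * convolve (suc m) f p) (convolve-scale m f a p) ⟩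
  a * convolve m f p + b * convolve (suc m) f p ∎
  where open ≡-Reasoning

Σ-upTo≡convolve : ∀ m f p → Σℚ (upTo (suc m)) (λ r → f r * coeff p (m ∸ r)) ≡ convolve m f p
Σ-upTo≡convolve m       f []      = trans (Σℚ-cong (upTo (suc m)) (λ {r} _ → *-zeroʳ (f r))) (Σℚ-zero (upTo (suc m)))
Σ-upTo≡convolve zero    f (c ∷ p) = trans (+-identityʳ _) (*-comm (f 0) c)
Σ-upTo≡convolve (suc m) f (c ∷ p) = begin
  Σℚ (upTo (suc (suc m))) G                          ≡⟨ cong (λ rs → Σℚ rs G) (sym (LP.applyUpTo-∷ʳ (λ i → i) (suc m))) ⟩
  Σℚ (upTo (suc m) ∷ʳ suc m) G                       ≡⟨ Σℚ-∷ʳ (upTo (suc m)) (suc m) G ⟩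
  Σℚ (upTo (suc m)) G + G (suc m)
    ≡⟨ cong₂ _+_ (Σℚ-cong (upTo (suc m)) shift) (cong (λ i → f (suc m) * coeff (c ∷ p) i) (ℕP.n∸n≡0 m)) ⟩
  Σℚ (upTo (suc m)) (λ r → f r * coeff p (m ∸ r)) + f (suc m) * c
    ≡⟨ cong₂ _+_ (Σ-upTo≡convolve m f p) (*-comm (f (suc m)) c) ⟩
  convolve m f p + c * f (suc m)                     ≡⟨ +-comm (convolve m f p) _ ⟩
  c * f (suc m) + convolve m f p                     ∎
  where
    open ≡-Reasoning
    G : ℕ → ℚ
    G r = f r * coeff (c ∷ p) (suc m ∸ r)
    shift : ∀ {r} → r ∈ upTo (suc m) → G r ≡ f r * coeff p (m ∸ r)
    shift {r} r∈ = cong (λ i → f r * coeff (c ∷ p) i) (ℕP.+-∸-assoc 1 (ℕP.<⇒≤pred (MembershipP.∈-upTo⁻ r∈)))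

-- Ring identities behind the recurrence

recurrence-occupied : ∀ X Y D w f₁ f₂ g₁ → Y * f₂ ≡ D * f₁ + g₁ →
  X * (Y * w * f₂) ≡ D * (X * w * f₁) + (0ℚ * (X * w * f₁) + X * w * g₁)
recurrence-occupied X Y D w f₁ f₂ g₁ rec = begin
  X * (Y * w * f₂)        ≡⟨ solve 4 (λ X Y w f₂ → X :* (Y :* w :* f₂) := X :* w :* (Y :* f₂)) refl X Y w f₂ ⟩
  X * w * (Y * f₂)        ≡⟨ cong (X * w *_) rec ⟩
  X * w * (D * f₁ + g₁)
    ≡⟨ solve 5 (λ X D w f₁ g₁ → X :* w :* (D :* f₁ :+ g₁) := D :* (X :* w :* f₁) :+ (con 0ℚ :* (X :* w :* f₁) :+ X :* w :* g₁))
               refl X D w f₁ g₁ ⟩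
  D * (X * w * f₁) + (0ℚ * (X * w * f₁) + X * w * g₁) ∎
  where open ≡-Reasoning

recurrence-absent : ∀ X Y D w f₀ f₁ f₂ g₀ g₁ → Y * f₂ ≡ (1ℚ + D) * f₁ + g₁ → X * f₁ ≡ D * f₀ + g₀ →
  X * (Y * w * f₂ + (1ℚ - w) * f₁) ≡ D * (X * w * f₁ + (1ℚ - w) * f₀) + (1ℚ * (X * w * f₁) + (X * w * g₁ + (1ℚ - w) * g₀))
recurrence-absent X Y D w f₀ f₁ f₂ g₀ g₁ rec₁ rec₀ = begin
  X * (Y * w * f₂ + (1ℚ - w) * f₁)
    ≡⟨ solve 5 (λ X Y w f₁ f₂ → X :* (Y :* w :* f₂ :+ (con 1ℚ :- w) :* f₁) := X :* w :* (Y :* f₂) :+ (con 1ℚ :- w) :* (X :* f₁))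
               refl X Y w f₁ f₂ ⟩
  X * w * (Y * f₂) + (1ℚ - w) * (X * f₁)
    ≡⟨ cong₂ (λ u v → X * w * u + (1ℚ - w) * v) rec₁ rec₀ ⟩
  X * w * ((1ℚ + D) * f₁ + g₁) + (1ℚ - w) * (D * f₀ + g₀)
    ≡⟨ solve 7 (λ X D w f₀ f₁ g₀ g₁ →
                  X :* w :* ((con 1ℚ :+ D) :* f₁ :+ g₁) :+ (con 1ℚ :- w) :* (D :* f₀ :+ g₀)
               := D :* (X :* w :* f₁ :+ (con 1ℚ :- w) :* f₀) :+ (con 1ℚ :* (X :* w :* f₁) :+ (X :* w :* g₁ :+ (con 1ℚ :- w) :* g₀)))
               refl X D w f₀ f₁ g₀ g₁ ⟩
  D * (X * w * f₁ + (1ℚ - w) * f₀) + (1ℚ * (X * w * f₁) + (X * w * g₁ + (1ℚ - w) * g₀)) ∎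
  where open ≡-Reasoning

recurrence-normal : ∀ X R D w N f₀ f₁ g₀ → X ≡ 1ℚ + R → X * f₁ ≡ D * f₀ + g₀ →
  X * ((X * w + N) * f₁) ≡ D * ((R * w + N) * f₀) + (1ℚ * (X * w * f₁) + (R * w + N) * g₀)
recurrence-normal X R D w N f₀ f₁ g₀ X≡ rec = begin
  X * ((X * w + N) * f₁)    ≡⟨ solve 4 (λ X w N f₁ → X :* ((X :* w :+ N) :* f₁) := (X :* w :+ N) :* (X :* f₁)) refl X w N f₁ ⟩
  (X * w + N) * (X * f₁)    ≡⟨ cong₂ (λ x y → (x * w + N) * y) X≡ rec ⟩
  ((1ℚ + R) * w + N) * (D * f₀ + g₀)
    ≡⟨ solve 6 (λ R D w N f₀ g₀ →
                  ((con 1ℚ :+ R) :* w :+ N) :* (D :* f₀ :+ g₀)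
               := D :* ((R :* w :+ N) :* f₀) :+ (w :* (D :* f₀ :+ g₀) :+ (R :* w :+ N) :* g₀))
               refl R D w N f₀ g₀ ⟩
  D * ((R * w + N) * f₀) + (w * (D * f₀ + g₀) + (R * w + N) * g₀)
    ≡⟨ cong (λ x → D * ((R * w + N) * f₀) + (w * x + (R * w + N) * g₀)) (sym rec) ⟩
  D * ((R * w + N) * f₀) + (w * (X * f₁) + (R * w + N) * g₀)
    ≡⟨ cong (λ x → D * ((R * w + N) * f₀) + (x + (R * w + N) * g₀))
            (solve 3 (λ w X f₁ → w :* (X :* f₁) := con 1ℚ :* (X :* w :* f₁)) refl w X f₁) ⟩
  D * ((R * w + N) * f₀) + (1ℚ * (X * w * f₁) + (R * w + N) * g₀) ∎
  where open ≡-Reasoning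

random-step-identity : ∀ A Δ C w T₀ T₁ S → A + Δ ≡ C → 1ℚ * T₁ ≡ C * T₀ + S →
  A * (w * T₀) + (Δ * T₀ + w * S) ≡ 1ℚ * w * T₁ + Δ * ((1ℚ - w) * T₀)
random-step-identity A Δ C w T₀ T₁ S A+Δ≡C rec = begin
  A * (w * T₀) + (Δ * T₀ + w * S)
    ≡⟨ solve 5 (λ A Δ w T₀ S → A :* (w :* T₀) :+ (Δ :* T₀ :+ w :* S)
                               := (A :+ Δ) :* (w :* T₀) :+ w :* S :+ Δ :* ((con 1ℚ :- w) :* T₀)) refl A Δ w T₀ S ⟩
  (A + Δ) * (w * T₀) + w * S + Δ * ((1ℚ - w) * T₀)
    ≡⟨ cong (λ x → x * (w * T₀) + w * S + Δ * ((1ℚ - w) * T₀)) A+Δ≡C ⟩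
  C * (w * T₀) + w * S + Δ * ((1ℚ - w) * T₀)
    ≡⟨ solve 5 (λ C w T₀ S Δ → C :* (w :* T₀) :+ w :* S :+ Δ :* ((con 1ℚ :- w) :* T₀)
                             := w :* (C :* T₀ :+ S) :+ Δ :* ((con 1ℚ :- w) :* T₀)) refl C w T₀ S Δ ⟩
  w * (C * T₀ + S) + Δ * ((1ℚ - w) * T₀)
    ≡⟨ cong (λ x → w * x + Δ * ((1ℚ - w) * T₀)) (sym rec) ⟩
  w * (1ℚ * T₁) + Δ * ((1ℚ - w) * T₀)
    ≡⟨ cong (_+ Δ * ((1ℚ - w) * T₀)) (solve 2 (λ w T₁ → w :* (con 1ℚ :* T₁) := con 1ℚ :* w :* T₁) refl w T₁) ⟩
  1ℚ * w * T₁ + Δ * ((1ℚ - w) * T₀) ∎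
  where open ≡-Reasoning

module _ (n k : ℕ) (w : Fin n → ℚ) where

  weight : Outcome n → ℚ
  weight o = monomial (misplaced o) w

  𝔼 : Dist n → ℚ
  𝔼 d = Σℚ d (λ qo → proj₁ qo * weight (proj₂ qo))

  F≡𝔼-process : F k n w ≡ 𝔼 (process k n)
  F≡𝔼-process = begin
    Σℚ (allSubsets n) (λ S → probMisplaced k n S * monomial S w)
      ≡⟨ Σℚ-cong (allSubsets n) (λ {S} _ → sym (Σℚ-*ʳ (process k n) (monomial S w) (select S))) ⟩
    Σℚ (allSubsets n) (λ S → Σℚ (process k n) (λ qo → select S qo * monomial S w))
      ≡⟨ Σℚ-swap (allSubsets n) (process k n) (λ S qo → select S qo * monomial S w) ⟩
    Σℚ (process k n) (λ qo → Σℚ (allSubsets n) (λ S → select S qo * monomial S w))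
      ≡⟨ Σℚ-cong (process k n) (λ {qo} _ → selected qo) ⟩
    𝔼 (process k n) ∎
    where
      open ≡-Reasoning
      select : Subset n → ℚ × Outcome n → ℚ
      select S qo = if does (VecP.≡-dec BoolP._≟_ (misplaced (proj₂ qo)) S) then proj₁ qo else 0ℚ
      selected : ∀ qo → Σℚ (allSubsets n) (λ S → select S qo * monomial S w) ≡ proj₁ qo * weight (proj₂ qo)
      selected (q , o) =
        trans (Σℚ-cong (allSubsets n) (λ {S} _ → if-then-0-* (does (VecP.≡-dec BoolP._≟_ (misplaced o) S)) q (monomial S w)))
              (Σℚ-allSubsets-select (misplaced o) (λ S → q * monomial S w))

  weight-[] : weight [] ≡ 1ℚ
  weight-[] = trans (Πℚ-cong (allFin n) (λ i → cong (λ b → if b then w i else 1ℚ) (misplaced-[] i))) (Πℚ-one (allFin n))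

  seatFactor : Fin n → Fin n → ℚ
  seatFactor p s = if does (s ≟ p) then 1ℚ else w p

  seatFactor-own : ∀ p → seatFactor p p ≡ 1ℚ
  seatFactor-own p with p ≟ p
  ... | yes _   = refl
  ... | no p≢p = ⊥-elim (p≢p refl)

  seatFactor-other : ∀ {p s} → s ≢ p → seatFactor p s ≡ w p
  seatFactor-other {p} {s} s≢p with s ≟ p
  ... | yes s≡p = ⊥-elim (s≢p s≡p)
  ... | no _    = refl

  weight-∷ : ∀ p s o → lookup (misplaced o) p ≡ false → weight ((p , s) ∷ o) ≡ seatFactor p s * weight o
  weight-∷ p s o p-placed = Πℚ-allFin-scaleAt p (seatFactor p s) _ _ at-p elsewhere
    where
      at-p : (if lookup (misplaced ((p , s) ∷ o)) p then w p else 1ℚ)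
           ≡ seatFactor p s * (if lookup (misplaced o) p then w p else 1ℚ)
      at-p rewrite misplaced-∷ p s o p | p-placed with p ≟ p | s ≟ p
      ... | no p≢p | _     = ⊥-elim (p≢p refl)
      ... | yes _  | yes _ = sym (*-identityˡ 1ℚ)
      ... | yes _  | no _  = sym (*-identityʳ (w p))
      elsewhere : ∀ i → p ≢ i →
        (if lookup (misplaced ((p , s) ∷ o)) i then w i else 1ℚ) ≡ (if lookup (misplaced o) i then w i else 1ℚ)
      elsewhere i p≢i rewrite misplaced-∷ p s o i with p ≟ i
      ... | yes p≡i = ⊥-elim (p≢i p≡i)
      ... | no _    = refl

  𝔼-scale : ∀ u d → 𝔼 (scale u d) ≡ u * 𝔼 d
  𝔼-scale u []            = sym (*-zeroʳ u)
  𝔼-scale u ((q , o) ∷ d) = trans (cong₂ _+_ (*-assoc u q _) (𝔼-scale u d)) (sym (*-distribˡ-+ u _ _))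

  𝔼-seatThen : ∀ p s d → All (λ qo → lookup (misplaced (proj₂ qo)) p ≡ false) d →
    𝔼 (seatThen p s d) ≡ seatFactor p s * 𝔼 d
  𝔼-seatThen p s []            []                  = sym (*-zeroʳ (seatFactor p s))
  𝔼-seatThen p s ((q , o) ∷ d) (p-placed ∷ placed) = begin
    q * weight ((p , s) ∷ o) + 𝔼 (seatThen p s d)
      ≡⟨ cong₂ _+_ (cong (q *_) (weight-∷ p s o p-placed)) (𝔼-seatThen p s d placed) ⟩
    q * (seatFactor p s * weight o) + seatFactor p s * 𝔼 d
      ≡⟨ cong (_+ seatFactor p s * 𝔼 d) (*-left-comm q (seatFactor p s) (weight o)) ⟩
    seatFactor p s * (q * weight o) + seatFactor p s * 𝔼 d
      ≡⟨ sym (*-distribˡ-+ (seatFactor p s) _ _) ⟩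
    seatFactor p s * 𝔼 ((q , o) ∷ d) ∎
    where open ≡-Reasoning

  -- The body of the local function uniform of run, which cannot be named from outside Defs.
  choose : Fin n → List (Fin n) → Subset n → List (Fin n) → Dist n
  choose p ps occ []           = []
  choose p ps occ es@(_ ∷ _) =
    concatMap (λ s → scale (ℤ.+ 1 / length es) (seatThen p s (run k ps (occ ∪ ⁅ s ⁆)))) es

  run-random : ∀ (p : Fin n) ps occ → absentMinded k p ∨ lookup occ p ≡ true →
    run k (p ∷ ps) occ ≡ choose p ps occ (emptySeats occ)
  run-random p ps occ random rewrite random with emptySeats occ
  ... | []    = refl
  ... | _ ∷ _ = refl

  run-seated : ∀ (p : Fin n) ps occ → absentMinded k p ∨ lookup occ p ≡ false →
    run k (p ∷ ps) occ ≡ seatThen p p (run k ps (occ ∪ ⁅ p ⁆))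
  run-seated p ps occ seated rewrite seated = refl

  MisplacedAmong : List (Fin n) → ℚ × Outcome n → Set
  MisplacedAmong ps qo = ∀ i → i ∉ ps → lookup (misplaced (proj₂ qo)) i ≡ false

  seatThen-misplacedAmong : ∀ p s ps d → All (MisplacedAmong ps) d → All (MisplacedAmong (p ∷ ps)) (seatThen p s d)
  seatThen-misplacedAmong p s ps []            []                = []
  seatThen-misplacedAmong p s ps ((q , o) ∷ d) (among ∷ amongs) = among′ ∷ seatThen-misplacedAmong p s ps d amongs
    where
      among′ : MisplacedAmong (p ∷ ps) (q , (p , s) ∷ o)
      among′ i i∉ rewrite misplaced-∷ p s o i with p ≟ i
      ... | yes refl = ⊥-elim (i∉ (here refl))
      ... | no _     = among i (i∉ ∘ there)

  scale-misplacedAmong : ∀ u ps d → All (MisplacedAmong ps) d → All (MisplacedAmong ps) (scale u d)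
  scale-misplacedAmong u ps []            []                = []
  scale-misplacedAmong u ps ((q , o) ∷ d) (among ∷ amongs) = among ∷ scale-misplacedAmong u ps d amongs

  run-misplacedAmong : ∀ ps occ → All (MisplacedAmong ps) (run k ps occ)
  run-misplacedAmong []       occ = (λ i _ → misplaced-[] i) ∷ []
  run-misplacedAmong (p ∷ ps) occ = by-case (absentMinded k p ∨ lookup occ p) refl
    where
      after : ∀ s → All (MisplacedAmong (p ∷ ps)) (seatThen p s (run k ps (occ ∪ ⁅ s ⁆)))
      after s = seatThen-misplacedAmong p s ps _ (run-misplacedAmong ps (occ ∪ ⁅ s ⁆))
      choose-misplacedAmong : ∀ es → All (MisplacedAmong (p ∷ ps)) (choose p ps occ es)
      choose-misplacedAmong []           = []
      choose-misplacedAmong es@(_ ∷ _) =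
        AllP.concat⁺ (AllP.map⁺ (All.universal (λ s → scale-misplacedAmong (ℤ.+ 1 / length es) (p ∷ ps) _ (after s)) es))
      by-case : ∀ b → absentMinded k p ∨ lookup occ p ≡ b → All (MisplacedAmong (p ∷ ps)) (run k (p ∷ ps) occ)
      by-case true  random = subst (All _) (sym (run-random p ps occ random)) (choose-misplacedAmong (emptySeats occ))
      by-case false seated = subst (All _) (sym (run-seated p ps occ seated)) (after p)

  -- The auxiliary polynomials Q

  step : Bool → Bool → Fin n → (ℕ → ℚ) → ℕ → ℚ
  step true  _     j f r = ℕ→ℚ (suc r) * w j * f (suc r)
  step false true  j f r = ℕ→ℚ (suc r) * w j * f (suc r) + (1ℚ - w j) * f r
  step false false j f r = (ℕ→ℚ r * w j + ℕ→ℚ (n ∸ toℕ j)) * f r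

  Q : List (Fin n) → Subset n → ℕ → ℚ
  Q []       occ r = 1ℚ
  Q (j ∷ js) occ r = step (lookup occ j) (absentMinded k j) j (Q js occ) r

  step-cong : ∀ b a j {f g} → (∀ r → f r ≡ g r) → ∀ r → step b a j f r ≡ step b a j g r
  step-cong true  _     j eq r = cong (ℕ→ℚ (suc r) * w j *_) (eq (suc r))
  step-cong false true  j eq r = cong₂ (λ x y → ℕ→ℚ (suc r) * w j * x + (1ℚ - w j) * y) (eq (suc r)) (eq r)
  step-cong false false j eq r = cong ((ℕ→ℚ r * w j + ℕ→ℚ (n ∸ toℕ j)) *_) (eq r)

  step-Σ : ∀ b a j (xs : List A) (h : A → ℕ → ℚ) r →
    step b a j (λ r → Σℚ xs (λ x → h x r)) r ≡ Σℚ xs (λ x → step b a j (h x) r)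
  step-Σ true  _     j xs h r = sym (Σℚ-*ˡ xs (ℕ→ℚ (suc r) * w j) (λ x → h x (suc r)))
  step-Σ false true  j xs h r = sym (trans (Σℚ-+ xs (λ x → ℕ→ℚ (suc r) * w j * h x (suc r)) (λ x → (1ℚ - w j) * h x r))
    (cong₂ _+_ (Σℚ-*ˡ xs (ℕ→ℚ (suc r) * w j) (λ x → h x (suc r))) (Σℚ-*ˡ xs (1ℚ - w j) (λ x → h x r))))
  step-Σ false false j xs h r = sym (Σℚ-*ˡ xs (ℕ→ℚ r * w j + ℕ→ℚ (n ∸ toℕ j)) (λ x → h x r))

  step-random : ∀ b a j f → a ∨ b ≡ true →
    step b a j f 0 ≡ 1ℚ * w j * f 1 + ℕ→ℚ (𝟙 (not b)) * ((1ℚ - w j) * f 0)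
  step-random true  a    j f _ = sym (trans (cong (1ℚ * w j * f 1 +_) (*-zeroˡ ((1ℚ - w j) * f 0))) (+-identityʳ _))
  step-random false true j f _ = cong (1ℚ * w j * f 1 +_) (sym (*-identityˡ _))

  Q-cong : ∀ js {o₁ o₂} → (∀ {x} → x ∈ js → lookup o₁ x ≡ lookup o₂ x) → ∀ r → Q js o₁ r ≡ Q js o₂ r
  Q-cong []       eq r = refl
  Q-cong (j ∷ js) {o₁} {o₂} eq r =
    trans (cong (λ b → step b (absentMinded k j) j (Q js o₁) r) (eq (here refl)))
          (step-cong (lookup o₂ j) (absentMinded k j) j (Q-cong js (eq ∘ there)) r)

  Q-occupy-outside : ∀ js occ {s} → s ∉ js → ∀ r → Q js (occ ∪ ⁅ s ⁆) r ≡ Q js occ r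
  Q-occupy-outside js occ s∉js = Q-cong js (λ x∈ → lookup-occupy-other occ (λ { refl → s∉js x∈ }))

  occupiedIn : List (Fin n) → Subset n → ℕ
  occupiedIn js occ = length (keep (lookup occ) js)

  ΣQ-occupy : List (Fin n) → Subset n → ℕ → ℚ
  ΣQ-occupy js occ r = Σℚ (keep (not ∘ lookup occ) js) (λ s → Q js (occ ∪ ⁅ s ⁆) r)

  ΣQ-occupy-∷ : ∀ j js occ → j ∉ js → ∀ r →
    ΣQ-occupy (j ∷ js) occ r
      ≡ ℕ→ℚ (𝟙 (not (lookup occ j))) * step true (absentMinded k j) j (Q js occ) r
        + step (lookup occ j) (absentMinded k j) j (ΣQ-occupy js occ) r
  ΣQ-occupy-∷ j js occ j∉js r = begin
    Σℚ (keep (not ∘ lookup occ) (j ∷ js)) (λ s → Q (j ∷ js) (occ ∪ ⁅ s ⁆) r)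
      ≡⟨ Σℚ-keep-∷ (not ∘ lookup occ) j js (λ s → Q (j ∷ js) (occ ∪ ⁅ s ⁆) r) ⟩
    ℕ→ℚ (𝟙 (not (lookup occ j))) * Q (j ∷ js) (occ ∪ ⁅ j ⁆) r + Σℚ (keep (not ∘ lookup occ) js) (λ s → Q (j ∷ js) (occ ∪ ⁅ s ⁆) r)
      ≡⟨ cong₂ (λ x y → ℕ→ℚ (𝟙 (not (lookup occ j))) * x + y) own-seat other-seats ⟩
    ℕ→ℚ (𝟙 (not (lookup occ j))) * step true a j (Q js occ) r + step (lookup occ j) a j (ΣQ-occupy js occ) r ∎
    where
      open ≡-Reasoning
      a = absentMinded k j
      own-seat : Q (j ∷ js) (occ ∪ ⁅ j ⁆) r ≡ step true a j (Q js occ) r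
      own-seat = trans (cong (λ b → step b a j (Q js (occ ∪ ⁅ j ⁆)) r) (lookup-occupy-self occ j))
                       (step-cong true a j (Q-occupy-outside js occ j∉js) r)
      other-seats : Σℚ (keep (not ∘ lookup occ) js) (λ s → Q (j ∷ js) (occ ∪ ⁅ s ⁆) r) ≡ step (lookup occ j) a j (ΣQ-occupy js occ) r
      other-seats = trans (Σℚ-cong (keep (not ∘ lookup occ) js) {f = λ s → Q (j ∷ js) (occ ∪ ⁅ s ⁆) r} (λ {s} s∈ →
                      cong (λ b → step b a j (Q js (occ ∪ ⁅ s ⁆)) r)
                           (lookup-occupy-other occ {s} (λ { refl → j∉js (proj₁ (∈-keep⁻ _ js s∈)) }))))
                    (sym (step-Σ (lookup occ j) a j (keep (not ∘ lookup occ) js) (λ s → Q js (occ ∪ ⁅ s ⁆)) r))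

  step-recurrence : ∀ {f g : ℕ → ℚ} c → (∀ r → ℕ→ℚ (suc r) * f (suc r) ≡ ℕ→ℚ (c ℕ.+ suc r) * f r + g r) →
    ∀ b a j r → ℕ→ℚ (suc r) * step b a j f (suc r)
              ≡ ℕ→ℚ (𝟙 b ℕ.+ c ℕ.+ suc r) * step b a j f r + (ℕ→ℚ (𝟙 (not b)) * step true a j f r + step b a j g r)
  step-recurrence {f} {g} c rec true a j r =
    recurrence-occupied (ℕ→ℚ (suc r)) (ℕ→ℚ (suc (suc r))) (ℕ→ℚ (suc (c ℕ.+ suc r))) (w j) (f (suc r)) (f (suc (suc r))) (g (suc r))
      (trans (rec (suc r)) (cong (λ m → ℕ→ℚ m * f (suc r) + g (suc r)) (ℕP.+-suc c (suc r))))
  step-recurrence {f} {g} c rec false true j r =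
    recurrence-absent (ℕ→ℚ (suc r)) (ℕ→ℚ (suc (suc r))) (ℕ→ℚ (c ℕ.+ suc r)) (w j) (f r) (f (suc r)) (f (suc (suc r))) (g r) (g (suc r))
      (trans (rec (suc r)) (cong (λ x → x * f (suc r) + g (suc r)) (trans (cong ℕ→ℚ (ℕP.+-suc c (suc r))) (ℕ→ℚ-+ 1 (c ℕ.+ suc r)))))
      (rec r)
  step-recurrence {f} {g} c rec false false j r =
    recurrence-normal (ℕ→ℚ (suc r)) (ℕ→ℚ r) (ℕ→ℚ (c ℕ.+ suc r)) (w j) (ℕ→ℚ (n ∸ toℕ j)) (f r) (f (suc r)) (g r)
      (ℕ→ℚ-+ 1 r) (rec r)

  Q-recurrence : ∀ js occ → Unique js → ∀ r →
    ℕ→ℚ (suc r) * Q js occ (suc r) ≡ ℕ→ℚ (occupiedIn js occ ℕ.+ suc r) * Q js occ r + ΣQ-occupy js occ r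
  Q-recurrence []       occ _                  r = sym (+-identityʳ _)
  Q-recurrence (j ∷ js) occ (j∉js ∷ unique) r = begin
    ℕ→ℚ (suc r) * Q (j ∷ js) occ (suc r)
      ≡⟨ step-recurrence (occupiedIn js occ) (Q-recurrence js occ unique) (lookup occ j) a j r ⟩
    ℕ→ℚ (𝟙 (lookup occ j) ℕ.+ occupiedIn js occ ℕ.+ suc r) * Q (j ∷ js) occ r
      + (ℕ→ℚ (𝟙 (not (lookup occ j))) * step true a j (Q js occ) r + step (lookup occ j) a j (ΣQ-occupy js occ) r)
      ≡⟨ sym (cong₂ (λ m x → ℕ→ℚ (m ℕ.+ suc r) * Q (j ∷ js) occ r + x)
                    (length-keep-∷ (lookup occ) j js) (ΣQ-occupy-∷ j js occ (All¬⇒¬Any j∉js) r)) ⟩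
    ℕ→ℚ (occupiedIn (j ∷ js) occ ℕ.+ suc r) * Q (j ∷ js) occ r + ΣQ-occupy (j ∷ js) occ r ∎
    where
      open ≡-Reasoning
      a = absentMinded k j

  factorial-𝔼-choose : ∀ p ps occ es {m} → p ∉ ps → length es ≡ suc m →
    ℕ→ℚ (suc m !) * 𝔼 (choose p ps occ es) ≡ Σℚ es (λ s → seatFactor p s * (ℕ→ℚ (m !) * 𝔼 (run k ps (occ ∪ ⁅ s ⁆))))
  factorial-𝔼-choose p ps occ es@(_ ∷ es′) p∉ps refl = begin
    ℕ→ℚ (suc m !) * 𝔼 (concatMap branch es)
      ≡⟨ cong (ℕ→ℚ (suc m !) *_) (trans (Σℚ-concatMap branch es (λ qo → proj₁ qo * weight (proj₂ qo))) (Σℚ-cong es (λ {s} _ → 𝔼-branch s))) ⟩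
    ℕ→ℚ (suc m !) * Σℚ es (λ s → u * (seatFactor p s * E s))
      ≡⟨ cong (ℕ→ℚ (suc m !) *_) (Σℚ-*ˡ es u (λ s → seatFactor p s * E s)) ⟩
    ℕ→ℚ (suc m !) * (u * Σℚ es (λ s → seatFactor p s * E s))
      ≡⟨ cong (_* (u * Σℚ es (λ s → seatFactor p s * E s))) (ℕ→ℚ-* (suc m) (m !)) ⟩
    ℕ→ℚ (suc m) * ℕ→ℚ (m !) * (u * Σ′)
      ≡⟨ solve 4 (λ M m! u Σ′ → M :* m! :* (u :* Σ′) := u :* M :* (m! :* Σ′)) refl (ℕ→ℚ (suc m)) (ℕ→ℚ (m !)) u Σ′ ⟩
    u * ℕ→ℚ (suc m) * (ℕ→ℚ (m !) * Σ′)
      ≡⟨ trans (cong (_* (ℕ→ℚ (m !) * Σ′)) (1/n*n≡1 (suc m))) (*-identityˡ _) ⟩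
    ℕ→ℚ (m !) * Σ′
      ≡⟨ sym (Σℚ-*ˡ es (ℕ→ℚ (m !)) (λ s → seatFactor p s * E s)) ⟩
    Σℚ es (λ s → ℕ→ℚ (m !) * (seatFactor p s * E s))
      ≡⟨ Σℚ-cong es (λ {s} _ → *-left-comm (ℕ→ℚ (m !)) (seatFactor p s) (E s)) ⟩
    Σℚ es (λ s → seatFactor p s * (ℕ→ℚ (m !) * E s)) ∎
    where
      open ≡-Reasoning
      m = length es′
      u = ℤ.+ 1 / suc m
      E : Fin n → ℚ
      E s = 𝔼 (run k ps (occ ∪ ⁅ s ⁆))
      Σ′ = Σℚ es (λ s → seatFactor p s * E s)
      branch : Fin n → Dist n
      branch s = scale u (seatThen p s (run k ps (occ ∪ ⁅ s ⁆)))
      𝔼-branch : ∀ s → 𝔼 (branch s) ≡ u * (seatFactor p s * E s)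
      𝔼-branch s = trans (𝔼-scale u (seatThen p s (run k ps (occ ∪ ⁅ s ⁆)))) (cong (u *_) (𝔼-seatThen p s (run k ps (occ ∪ ⁅ s ⁆))
        (All.map (λ among → among p p∉ps) (run-misplacedAmong ps (occ ∪ ⁅ s ⁆)))))

  Σ-emptySeats-split : ∀ pre p ps occ → allFin n ≡ pre ++ p ∷ ps →
    Σℚ (emptySeats occ) (λ s → seatFactor p s * Q ps (occ ∪ ⁅ s ⁆) 0)
      ≡ ℕ→ℚ (length (keep (not ∘ lookup occ) pre)) * (w p * Q ps occ 0)
        + (ℕ→ℚ (𝟙 (not (lookup occ p))) * Q ps occ 0 + w p * ΣQ-occupy ps occ 0)
  Σ-emptySeats-split pre p ps occ split = begin
    Σℚ (keep free (allFin n)) G                          ≡⟨ cong (λ xs → Σℚ (keep free xs) G) split ⟩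
    Σℚ (keep free (pre ++ p ∷ ps)) G                     ≡⟨ cong (λ xs → Σℚ xs G) (keep-++ free pre (p ∷ ps)) ⟩
    Σℚ (keep free pre ++ keep free (p ∷ ps)) G           ≡⟨ Σℚ-++ (keep free pre) _ G ⟩
    Σℚ (keep free pre) G + Σℚ (keep free (p ∷ ps)) G     ≡⟨ cong (Σℚ (keep free pre) G +_) (Σℚ-keep-∷ free p ps G) ⟩
    Σℚ (keep free pre) G + (ℕ→ℚ (𝟙 (free p)) * G p + Σℚ (keep free ps) G)
      ≡⟨ cong₂ (λ x y → x + (ℕ→ℚ (𝟙 (free p)) * y + Σℚ (keep free ps) G)) earlier own ⟩
    ℕ→ℚ (length (keep free pre)) * (w p * T₀) + (ℕ→ℚ (𝟙 (free p)) * T₀ + Σℚ (keep free ps) G)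
      ≡⟨ cong (λ x → ℕ→ℚ (length (keep free pre)) * (w p * T₀) + (ℕ→ℚ (𝟙 (free p)) * T₀ + x)) later ⟩
    ℕ→ℚ (length (keep free pre)) * (w p * T₀) + (ℕ→ℚ (𝟙 (free p)) * T₀ + w p * ΣQ-occupy ps occ 0) ∎
    where
      open ≡-Reasoning
      free = not ∘ lookup occ
      T₀ = Q ps occ 0
      G : Fin n → ℚ
      G s = seatFactor p s * Q ps (occ ∪ ⁅ s ⁆) 0
      unique : Unique (pre ++ p ∷ ps)
      unique = subst Unique split (UniqueP.allFin⁺ n)
      p∉ps : p ∉ ps
      p∉ps with p∉ ∷ _ ← allFin-suffix-Unique pre p ps split = All¬⇒¬Any p∉
      earlier : Σℚ (keep free pre) G ≡ ℕ→ℚ (length (keep free pre)) * (w p * T₀)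
      earlier = trans (Σℚ-cong (keep free pre) {f = G} (λ {s} s∈ → let s∉ = Unique-++-disjoint pre unique (proj₁ (∈-keep⁻ free pre s∈)) in
                        cong₂ _*_ (seatFactor-other {s = s} (λ { refl → s∉ (here refl) })) (Q-occupy-outside ps occ (s∉ ∘ there) 0)))
                      (Σℚ-const (keep free pre) (w p * T₀))
      own : G p ≡ T₀
      own = trans (cong₂ _*_ (seatFactor-own p) (Q-occupy-outside ps occ p∉ps 0)) (*-identityˡ T₀)
      later : Σℚ (keep free ps) G ≡ w p * ΣQ-occupy ps occ 0
      later = trans (Σℚ-cong (keep free ps) {f = G} (λ {s} s∈ →
                       cong (_* Q ps (occ ∪ ⁅ s ⁆) 0) (seatFactor-other {s = s} (λ { refl → p∉ps (proj₁ (∈-keep⁻ free ps s∈)) }))))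
                    (Σℚ-*ˡ (keep free ps) (w p) (λ s → Q ps (occ ∪ ⁅ s ⁆) 0))

  free-seat-balance : ∀ pre p ps occ → allFin n ≡ pre ++ p ∷ ps → length (emptySeats occ) ≡ suc (length ps) →
    length (keep (not ∘ lookup occ) pre) ℕ.+ 𝟙 (not (lookup occ p)) ≡ occupiedIn ps occ ℕ.+ 1
  free-seat-balance pre p ps occ split total = ℕP.+-cancelʳ-≡ f (a ℕ.+ δ) (c ℕ.+ 1) (begin
    a ℕ.+ δ ℕ.+ f                                ≡⟨ ℕP.+-assoc a δ f ⟩
    a ℕ.+ (δ ℕ.+ f)                              ≡⟨ cong (a ℕ.+_) (sym (length-keep-∷ free p ps)) ⟩
    a ℕ.+ length (keep free (p ∷ ps))            ≡⟨ sym (LP.length-++ (keep free pre)) ⟩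
    length (keep free pre ++ keep free (p ∷ ps)) ≡⟨ cong length (sym (keep-++ free pre (p ∷ ps))) ⟩
    length (keep free (pre ++ p ∷ ps))           ≡⟨ cong (length ∘ keep free) (sym split) ⟩
    length (emptySeats occ)                      ≡⟨ total ⟩
    suc (length ps)                              ≡⟨ cong suc (sym (length-keep-not (lookup occ) ps)) ⟩
    suc (f ℕ.+ c)                                ≡⟨ cong suc (ℕP.+-comm f c) ⟩
    suc (c ℕ.+ f)                                ≡⟨ cong (ℕ._+ f) (ℕP.+-comm 1 c) ⟩
    c ℕ.+ 1 ℕ.+ f                                ∎)
    where
      open ≡-Reasoning
      free = not ∘ lookup occ
      a = length (keep free pre)
      δ = 𝟙 (free p)
      f = length (keep free ps)
      c = occupiedIn ps occ

  factorial-𝔼-random : ∀ pre p ps occ → allFin n ≡ pre ++ p ∷ ps → length (emptySeats occ) ≡ suc (length ps) →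
    absentMinded k p ∨ lookup occ p ≡ true →
    (∀ s → s ∈ emptySeats occ → ℕ→ℚ (length ps !) * 𝔼 (run k ps (occ ∪ ⁅ s ⁆)) ≡ Q ps (occ ∪ ⁅ s ⁆) 0) →
    ℕ→ℚ (suc (length ps) !) * 𝔼 (run k (p ∷ ps) occ)
      ≡ 1ℚ * w p * Q ps occ 1 + ℕ→ℚ (𝟙 (not (lookup occ p))) * ((1ℚ - w p) * Q ps occ 0)
  factorial-𝔼-random pre p ps occ split total random IH
    with p∉ps ∷ unique ← allFin-suffix-Unique pre p ps split = begin
    ℕ→ℚ (suc (length ps) !) * 𝔼 (run k (p ∷ ps) occ)
      ≡⟨ cong (λ d → ℕ→ℚ (suc (length ps) !) * 𝔼 d) (run-random p ps occ random) ⟩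
    ℕ→ℚ (suc (length ps) !) * 𝔼 (choose p ps occ (emptySeats occ))
      ≡⟨ factorial-𝔼-choose p ps occ (emptySeats occ) (All¬⇒¬Any p∉ps) total ⟩
    Σℚ (emptySeats occ) (λ s → seatFactor p s * (ℕ→ℚ (length ps !) * 𝔼 (run k ps (occ ∪ ⁅ s ⁆))))
      ≡⟨ Σℚ-cong (emptySeats occ) (λ {s} s∈ → cong (seatFactor p s *_) (IH s s∈)) ⟩
    Σℚ (emptySeats occ) (λ s → seatFactor p s * Q ps (occ ∪ ⁅ s ⁆) 0)
      ≡⟨ Σ-emptySeats-split pre p ps occ split ⟩
    ℕ→ℚ a * (w p * Q ps occ 0) + (ℕ→ℚ δ * Q ps occ 0 + w p * ΣQ-occupy ps occ 0)
      ≡⟨ random-step-identity (ℕ→ℚ a) (ℕ→ℚ δ) (ℕ→ℚ (occupiedIn ps occ ℕ.+ 1)) (w p) (Q ps occ 0) (Q ps occ 1) (ΣQ-occupy ps occ 0)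
           (trans (sym (ℕ→ℚ-+ a δ)) (cong ℕ→ℚ (free-seat-balance pre p ps occ split total)))
           (Q-recurrence ps occ unique 0) ⟩
    1ℚ * w p * Q ps occ 1 + ℕ→ℚ δ * ((1ℚ - w p) * Q ps occ 0) ∎
    where
      open ≡-Reasoning
      a = length (keep (not ∘ lookup occ) pre)
      δ = 𝟙 (not (lookup occ p))

  factorial-𝔼-seated : ∀ pre p ps occ → allFin n ≡ pre ++ p ∷ ps → absentMinded k p ∨ lookup occ p ≡ false →
    ℕ→ℚ (length ps !) * 𝔼 (run k ps (occ ∪ ⁅ p ⁆)) ≡ Q ps (occ ∪ ⁅ p ⁆) 0 →
    ℕ→ℚ (suc (length ps) !) * 𝔼 (run k (p ∷ ps) occ) ≡ (ℕ→ℚ 0 * w p + ℕ→ℚ (n ∸ toℕ p)) * Q ps occ 0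
  factorial-𝔼-seated pre p ps occ split seated IH
    with p∉ps ∷ _ ← allFin-suffix-Unique pre p ps split = begin
    ℕ→ℚ (suc L !) * 𝔼 (run k (p ∷ ps) occ)
      ≡⟨ cong (λ d → ℕ→ℚ (suc L !) * 𝔼 d) (run-seated p ps occ seated) ⟩
    ℕ→ℚ (suc L !) * 𝔼 (seatThen p p (run k ps (occ ∪ ⁅ p ⁆)))
      ≡⟨ cong (ℕ→ℚ (suc L !) *_) (trans (𝔼-seatThen p p _ placed) (trans (cong (_* E) (seatFactor-own p)) (*-identityˡ E))) ⟩
    ℕ→ℚ (suc L !) * E
      ≡⟨ trans (cong (_* E) (ℕ→ℚ-* (suc L) (L !))) (*-assoc (ℕ→ℚ (suc L)) (ℕ→ℚ (L !)) E) ⟩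
    ℕ→ℚ (suc L) * (ℕ→ℚ (L !) * E)
      ≡⟨ cong (ℕ→ℚ (suc L) *_) (trans IH (Q-occupy-outside ps occ (All¬⇒¬Any p∉ps) 0)) ⟩
    ℕ→ℚ (suc L) * Q ps occ 0
      ≡⟨ cong (_* Q ps occ 0) (sym own-seat-count) ⟩
    (ℕ→ℚ 0 * w p + ℕ→ℚ (n ∸ toℕ p)) * Q ps occ 0 ∎
    where
      open ≡-Reasoning
      L = length ps
      E = 𝔼 (run k ps (occ ∪ ⁅ p ⁆))
      placed : All (λ qo → lookup (misplaced (proj₂ qo)) p ≡ false) (run k ps (occ ∪ ⁅ p ⁆))
      placed = All.map (λ among → among p (All¬⇒¬Any p∉ps)) (run-misplacedAmong ps (occ ∪ ⁅ p ⁆))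
      own-seat-count : ℕ→ℚ 0 * w p + ℕ→ℚ (n ∸ toℕ p) ≡ ℕ→ℚ (suc L)
      own-seat-count = trans (cong (_+ ℕ→ℚ (n ∸ toℕ p)) (*-zeroˡ (w p)))
                             (trans (+-identityˡ _) (cong ℕ→ℚ (allFin-∸-position pre p ps split)))

  factorial-𝔼-run : ∀ pre ps occ → allFin n ≡ pre ++ ps → length (emptySeats occ) ≡ length ps →
    ℕ→ℚ (length ps !) * 𝔼 (run k ps occ) ≡ Q ps occ 0
  factorial-𝔼-run pre []       occ _     _     =
    trans (*-identityˡ _) (trans (+-identityʳ _) (trans (*-identityˡ _) weight-[]))
  factorial-𝔼-run pre (p ∷ ps) occ split total = by-case (absentMinded k p ∨ lookup occ p) refl
    where
      IH : ∀ s → lookup occ s ≡ false → ℕ→ℚ (length ps !) * 𝔼 (run k ps (occ ∪ ⁅ s ⁆)) ≡ Q ps (occ ∪ ⁅ s ⁆) 0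
      IH s free = factorial-𝔼-run (pre ++ [ p ]) ps (occ ∪ ⁅ s ⁆) (trans split (sym (LP.++-assoc pre [ p ] ps)))
                    (ℕP.suc-injective (trans (sym (length-emptySeats-occupy occ s free)) total))
      by-case : ∀ b → absentMinded k p ∨ lookup occ p ≡ b → ℕ→ℚ (suc (length ps) !) * 𝔼 (run k (p ∷ ps) occ) ≡ Q (p ∷ ps) occ 0
      by-case true  random =
        trans (factorial-𝔼-random pre p ps occ split total random
                 (λ s s∈ → IH s (BoolP.not-injective (proj₂ (∈-keep⁻ _ (allFin n) s∈)))))
              (sym (step-random (lookup occ p) (absentMinded k p) p (Q ps occ) random))
      by-case false seated =
        trans (factorial-𝔼-seated pre p ps occ split seated (IH p own-seat-free))
              (sym (cong₂ (λ b a → step b a p (Q ps occ) 0) own-seat-free (BoolP.∨-conicalˡ (absentMinded k p) _ seated)))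
        where own-seat-free = BoolP.∨-conicalʳ (absentMinded k p) (lookup occ p) seated

  linearProduct : List (Fin n) → List ℚ
  linearProduct = foldr (λ j acc → mulLin (1ℚ - w j) (w j) acc) (1ℚ ∷ [])

  normalFactors : List (Fin n) → ℕ → ℚ
  normalFactors js r = Πℚ js (λ j → ℕ→ℚ r * w j + ℕ→ℚ (n ∸ toℕ j))

  Q-normal : ∀ js → All (λ j → absentMinded k j ≡ false) js → ∀ r → Q js allEmpty r ≡ normalFactors js r
  Q-normal []       []                r = refl
  Q-normal (j ∷ js) (normal ∷ normals) r =
    trans (cong₂ (λ b a → step b a j (Q js allEmpty) r) (lookup-allEmpty j) normal)
          (cong ((ℕ→ℚ r * w j + ℕ→ℚ (n ∸ toℕ j)) *_) (Q-normal js normals r))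

  Q-absent : ∀ as bs → All (λ j → absentMinded k j ≡ true) as → ∀ r →
    ℕ→ℚ (r !) * Q (as ++ bs) allEmpty r ≡ convolve (r ℕ.+ length as) (λ m → ℕ→ℚ (m !) * Q bs allEmpty m) (linearProduct as)
  Q-absent []       bs []                r =
    trans (sym (convolve-one r _)) (cong (λ m → convolve m (λ m → ℕ→ℚ (m !) * Q bs allEmpty m) (1ℚ ∷ [])) (sym (ℕP.+-identityʳ r)))
  Q-absent (j ∷ as) bs (absent ∷ absents) r = begin
    ℕ→ℚ (r !) * Q (j ∷ as ++ bs) allEmpty r
      ≡⟨ cong₂ (λ b a → ℕ→ℚ (r !) * step b a j Q′ r) (lookup-allEmpty j) absent ⟩
    ℕ→ℚ (r !) * (ℕ→ℚ (suc r) * w j * Q′ (suc r) + (1ℚ - w j) * Q′ r)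
      ≡⟨ solve 5 (λ r! X w q₁ q₀ → r! :* (X :* w :* q₁ :+ (con 1ℚ :- w) :* q₀)
                                  := (con 1ℚ :- w) :* (r! :* q₀) :+ w :* (X :* r! :* q₁))
               refl (ℕ→ℚ (r !)) (ℕ→ℚ (suc r)) (w j) (Q′ (suc r)) (Q′ r) ⟩
    (1ℚ - w j) * (ℕ→ℚ (r !) * Q′ r) + w j * (ℕ→ℚ (suc r) * ℕ→ℚ (r !) * Q′ (suc r))
      ≡⟨ cong (λ x → (1ℚ - w j) * (ℕ→ℚ (r !) * Q′ r) + w j * (x * Q′ (suc r))) (sym (ℕ→ℚ-* (suc r) (r !))) ⟩
    (1ℚ - w j) * (ℕ→ℚ (r !) * Q′ r) + w j * (ℕ→ℚ (suc r !) * Q′ (suc r))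
      ≡⟨ cong₂ (λ x y → (1ℚ - w j) * x + w j * y) (Q-absent as bs absents r) (Q-absent as bs absents (suc r)) ⟩
    (1ℚ - w j) * convolve (r ℕ.+ length as) g (linearProduct as) + w j * convolve (suc r ℕ.+ length as) g (linearProduct as)
      ≡⟨ sym (convolve-mulLin (r ℕ.+ length as) g (1ℚ - w j) (w j) (linearProduct as)) ⟩
    convolve (suc (r ℕ.+ length as)) g (linearProduct (j ∷ as))
      ≡⟨ cong (λ m → convolve m g (linearProduct (j ∷ as))) (sym (ℕP.+-suc r (length as))) ⟩
    convolve (r ℕ.+ length (j ∷ as)) g (linearProduct (j ∷ as)) ∎
    where
      open ≡-Reasoning
      Q′ = Q (as ++ bs) allEmpty
      g : ℕ → ℚ
      g m = ℕ→ℚ (m !) * Q bs allEmpty m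

  Q-allFin : k ≤ n → Q (allFin n) allEmpty 0
    ≡ Σℚ (upTo (suc k)) (λ r → ℕ→ℚ (r !) * e k w (k ∸ r) * normalFactors (keep (not ∘ absentMinded k) (allFin n)) r)
  Q-allFin k≤n = begin
    Q (allFin n) allEmpty 0                         ≡⟨ cong (λ js → Q js allEmpty 0) (allFin-partition n k) ⟩
    Q (as ++ bs) allEmpty 0                         ≡⟨ sym (*-identityˡ _) ⟩
    ℕ→ℚ (0 !) * Q (as ++ bs) allEmpty 0             ≡⟨ Q-absent as bs absents 0 ⟩
    convolve (length as) (λ m → ℕ→ℚ (m !) * Q bs allEmpty m) (linearProduct as)
      ≡⟨ cong (λ m → convolve m (λ m → ℕ→ℚ (m !) * Q bs allEmpty m) (linearProduct as)) (length-keep-absentMinded n k k≤n) ⟩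
    convolve k (λ m → ℕ→ℚ (m !) * Q bs allEmpty m) (linearProduct as)
      ≡⟨ convolve-cong k (λ m → cong (ℕ→ℚ (m !) *_) (Q-normal bs normals m)) (linearProduct as) ⟩
    convolve k g (linearProduct as)                 ≡⟨ sym (Σ-upTo≡convolve k g (linearProduct as)) ⟩
    Σℚ (upTo (suc k)) (λ r → g r * coeff (linearProduct as) (k ∸ r))
      ≡⟨ Σℚ-cong (upTo (suc k)) (λ {r} _ → *-right-comm (ℕ→ℚ (r !)) (normalFactors bs r) _) ⟩
    Σℚ (upTo (suc k)) (λ r → ℕ→ℚ (r !) * e k w (k ∸ r) * normalFactors bs r) ∎
    where
      open ≡-Reasoning
      as = keep (absentMinded k) (allFin n)
      bs = keep (not ∘ absentMinded k) (allFin n)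
      absents : All (λ j → absentMinded k j ≡ true) as
      absents = All.tabulate (λ j∈ → proj₂ (∈-keep⁻ _ (allFin n) j∈))
      normals : All (λ j → absentMinded k j ≡ false) bs
      normals = All.tabulate (λ j∈ → BoolP.not-injective (proj₂ (∈-keep⁻ _ (allFin n) j∈)))
      g : ℕ → ℚ
      g r = ℕ→ℚ (r !) * normalFactors bs r

theorem4 : (n k : ℕ) → 1 ≤ k → k ≤ n → (w : Fin n → ℚ) → F k n w ≡ RHS k n w
theorem4 n k _ k≤n w = begin
  F k n w                                                  ≡⟨ F≡𝔼-process n k w ⟩
  𝔼 n k w (process k n)                                    ≡⟨ sym (*-identityˡ _) ⟩
  1ℚ * 𝔼 n k w (process k n)                               ≡⟨ cong (_* 𝔼 n k w (process k n)) (sym (1/n*n≡1 (n !) {{ℕP._!≢0 n}})) ⟩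
  u * ℕ→ℚ (n !) * 𝔼 n k w (process k n)                    ≡⟨ *-assoc u _ _ ⟩
  u * (ℕ→ℚ (n !) * 𝔼 n k w (process k n))                  ≡⟨ cong (λ m → u * (ℕ→ℚ (m !) * 𝔼 n k w (process k n))) (sym length-allFin) ⟩
  u * (ℕ→ℚ (length (allFin n) !) * 𝔼 n k w (process k n))
    ≡⟨ cong (u *_) (factorial-𝔼-run n k w [] (allFin n) allEmpty refl (cong length nobody-seated)) ⟩
  u * Q n k w (allFin n) allEmpty 0                        ≡⟨ cong (u *_) (Q-allFin n k w k≤n) ⟩
  RHS k n w                                                ∎
  where
    open ≡-Reasoning
    u = (ℤ.+ 1 / (n !)) {{ℕP._!≢0 n}}
    length-allFin : length (allFin n) ≡ n
    length-allFin = LP.length-tabulate (λ i → i)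
    nobody-seated : emptySeats allEmpty ≡ allFin n
    nobody-seated = keep-all _ (allFin n) (λ j → cong not (lookup-allEmpty j))
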